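{- Let $\hat{\mathcal Z}$ be the set of all irreducible Scott closed subsets of $\mathcal Z$, ordered by inclusion. Then $\Gamma\mathcal Z\cong\Gamma\hat{\mathcal Z}$, i.e. the lattice of Scott closed subsets of $\mathcal Z$ is order-isomorphic to the lattice of Scott closed subsets of the poset $\hat{\mathcal Z}$.
   Context: Let $\omega_1$ be the first uncountable ordinal and $\mathbb W=[0,\omega_1)$ the set of countable ordinals with their usual order. Let $\mathbb W^*$ be the set of finite strings of elements of $\mathbb W$, with $\varepsilon$ the empty string; for $u\in\mathbb W$, $s\in\mathbb W^*$, $u.s$ is the string obtained by putting $u$ in front of $s$; for $s,t\in\mathbb W^*$, $ts$ is the concatenation of $t$ followed by $s$; for nonempty $t$, $\min(t)$ is the least ordinal occurring in $t$. On $\mathcal Z=\mathbb W\times\mathbb W^*$ define, for $m,m',u,u'\in\mathbb W$ and $s,t\in\mathbb W^*$: $(m,u.s)<_1(m,u'.s)$ iff $u<u'$; $(m,ts)<_2(m,s)$ iff $t\neq\varepsilon$; $(m,ts)<_3(m',s)$ iff $t\ne\varepsilon$ and $\min(t)\le m'$. With $R;S$ the relational composite, let $<\,=\,<_1\cup<_2\cup<_3\cup(<_2;<_1)\cup(<_3;<_1)$ and $\le\,=\,<\cup=$; this is a partial order and $\mathcal Z$ denotes the resulting poset. For a poset $P$, Scott closed sets are lower sets containing the supremum of each of their directed subsets whose supremum exists; $\Gamma P$ is the set of Scott closed subsets of $P$ ordered by inclusion. A Scott closed set $C$ is irreducible if it is nonempty and $C\subseteq A\cup B$ with $A,B$ Scott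 closed implies $C\subseteq A$ or $C\subseteq B$. -}

module Defs where

open import Level using (Level; _⊔_; 0ℓ) renaming (suc to lsuc)
open import Data.Nat using (ℕ)
open import Data.List using (List; []; _∷_; _++_)
open import Data.Product using (Σ; ∃; _×_; _,_; proj₁; proj₂)
open import Data.Sum using (_⊎_; inj₁; inj₂)
open import Relation.Nullary using (¬_)
open import Relation.Binary using (Rel; IsStrictTotalOrder; Tri; tri<; tri≈; tri>)
open import Relation.Binary.PropositionalEquality using (_≡_; _≢_)
open import Induction.WellFounded using (WellFounded)
open import Relation.Unary using (Pred; _⊆_; _∪_)

module OrderNotions {a r : Level} (A : Set a) (_≤_ : Rel A r) where

  IsUpperBound : ∀ {ℓ} → Pred A ℓ → A → Set (a ⊔ r ⊔ ℓ)
  IsUpperBound D s = ∀ x → D x → x ≤ s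

  IsSup : ∀ {ℓ} → Pred A ℓ → A → Set (a ⊔ r ⊔ ℓ)
  IsSup D s = IsUpperBound D s × (∀ t → IsUpperBound D t → s ≤ t)

  Directed : ∀ {ℓ} → Pred A ℓ → Set (a ⊔ r ⊔ ℓ)
  Directed D = (∃ λ x → D x)
             × (∀ x y → D x → D y → ∃ λ z → D z × (x ≤ z) × (y ≤ z))

  LowerSet : ∀ {ℓ} → Pred A ℓ → Set (a ⊔ r ⊔ ℓ)
  LowerSet C = ∀ x y → x ≤ y → C y → C x

  IsScottClosed : ∀ {ℓ} → Pred A ℓ → Set (a ⊔ r ⊔ lsuc ℓ)
  IsScottClosed {ℓ} C =
    LowerSet C
    × (∀ (D : Pred A ℓ) → Directed D → D ⊆ C → ∀ s → IsSup D s → C s)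

  Γ : (ℓ : Level) → Set (a ⊔ r ⊔ lsuc ℓ)
  Γ ℓ = Σ (Pred A ℓ) IsScottClosed

  _⊑Γ_ : ∀ {ℓ} → Rel (Γ ℓ) (a ⊔ ℓ)
  C ⊑Γ C' = proj₁ C ⊆ proj₁ C'

  IsIrreducible : ∀ {ℓ} → Pred A ℓ → Set (a ⊔ r ⊔ lsuc ℓ)
  IsIrreducible {ℓ} C =
    IsScottClosed C
    × (∃ λ x → C x)
    × (∀ (P Q : Γ ℓ) → C ⊆ (proj₁ P ∪ proj₁ Q) → C ⊆ proj₁ P ⊎ C ⊆ proj₁ Q)

-- Order isomorphism between two preordered sets (posets presented up
-- to the equivalence x ≤ y × y ≤ x).

record OrderIso {a r b s : Level} (A : Set a) (_≤A_ : Rel A r)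
                (B : Set b) (_≤B_ : Rel B s) : Set (a ⊔ r ⊔ b ⊔ s) where
  field
    to      : A → B
    from    : B → A
    to-mono   : ∀ {x y} → x ≤A y → to x ≤B to y
    from-mono : ∀ {x y} → x ≤B y → from x ≤A from y
    from-to : ∀ x → (from (to x) ≤A x) × (x ≤A from (to x))
    to-from : ∀ y → (to (from y) ≤B y) × (y ≤B to (from y))

-- ω₁ : a well-ordered set which is uncountable but all of whose proper
-- initial segments are countable (this characterises ω₁ up to
-- isomorphism).

record Omega1 : Set₁ where
  field
    W    : Set
    _<_  : Rel W 0ℓ
    isSTO : IsStrictTotalOrder _≡_ _<_
    wf   : WellFounded _<_
    uncountable : ¬ (Σ (W → ℕ) λ f → ∀ x y → f x ≡ f y → x ≡ y)
    segmentsCountable : ∀ α → Σ (Σ W (λ β → β < α) → ℕ) λ f →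
      ∀ x y → f x ≡ f y → proj₁ x ≡ proj₁ y

module Construction (Ω : Omega1) where
  open Omega1 Ω public
  open IsStrictTotalOrder isSTO using (compare)

  _≤W_ : Rel W 0ℓ
  x ≤W y = x < y ⊎ x ≡ y

  min2 : W → W → W
  min2 x y with compare x y
  ... | tri< _ _ _ = x
  ... | tri≈ _ _ _ = x
  ... | tri> _ _ _ = y

  minL : W → List W → W
  minL u []      = u
  minL u (v ∷ t) = min2 u (minL v t)

  W* : Set
  W* = List W

  Z : Set
  Z = W × W*

  data _<₁_ : Rel Z 0ℓ where
    lt₁ : ∀ {m u u' s} → u < u' → (m , u ∷ s) <₁ (m , u' ∷ s)

  data _<₂_ : Rel Z 0ℓ where
    lt₂ : ∀ {m} (t s : W*) → t ≢ [] → (m , t ++ s) <₂ (m , s)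

  -- t = u.t' is nonempty, min(t) = minL u t'
  data _<₃_ : Rel Z 0ℓ where
    lt₃ : ∀ {m m'} (u : W) (t' s : W*) → minL u t' ≤W m' →
          (m , (u ∷ t') ++ s) <₃ (m' , s)

  _⨾_ : Rel Z 0ℓ → Rel Z 0ℓ → Rel Z 0ℓ
  (R ⨾ S) x z = ∃ λ y → R x y × S y z

  _<Z_ : Rel Z 0ℓ
  x <Z y = x <₁ y ⊎ x <₂ y ⊎ x <₃ y ⊎ (_<₂_ ⨾ _<₁_) x y ⊎ (_<₃_ ⨾ _<₁_) x y

  _≤Z_ : Rel Z 0ℓ
  x ≤Z y = x <Z y ⊎ x ≡ y

  open OrderNotions Z _≤Z_ public using () renaming
    (Γ to ΓZ-at; _⊑Γ_ to _⊑ΓZ_; IsIrreducible to IsIrreducibleZ; IsScottClosed to IsScottClosedZ)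

  ΓZ : Set₁
  ΓZ = ΓZ-at 0ℓ

  Ẑ : Set₁
  Ẑ = Σ (Pred Z 0ℓ) IsIrreducibleZ

  _⊆Ẑ_ : Rel Ẑ 0ℓ
  C ⊆Ẑ C' = proj₁ C ⊆ proj₁ C'

  open OrderNotions Ẑ _⊆Ẑ_ public using () renaming (Γ to ΓẐ-at; _⊑Γ_ to _⊑ΓẐ_)

  -- Γ𝒵̂ (subsets of 𝒵̂ taken at level 1, the natural powerset level)
  ΓẐ : Set₂
  ΓẐ = ΓẐ-at (lsuc 0ℓ)

{-# OPTIONS --safe #-}
module Submission where

-- For any preorder P, C ↦ {A ∈ P̂ ∣ A ⊆ C} and 𝒜 ↦ {x ∣ ↓ x ∈ 𝒜} are inverse
-- isomorphisms Γ P ≅ Γ P̂ once P is dominated: each irreducible closed A lies in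
-- every Scott closed 𝒜 ⊆ P̂ containing all ↓ x with x ∈ A.  𝒵 is dominated since
-- an irreducible closed A ⊆ 𝒵 is either ↓ a with a ∈ A, or X σ = {(k , q) ∣ q ⊑ σ}
-- with all (k , σ) ∈ A, the directed supremum in 𝒵̂ of the X (u.σ) ⊆ ↓ (u , σ).
-- To classify A: by a normal form of ≤, Scott closed means closed under the
-- suprema (k , r) of the chains (k , u.r)ᵤ and (k , w.r) of (k , u.r)_{u<w} for
-- limit w; every point of A lies below a maximal point; and irreducibility
-- applied to a two-piece cover of A yields one of the two shapes.

open import Defs
open import Level using (Level; Lift; lift; lower; _⊔_; 0ℓ) renaming (suc to lsuc)
open import Axiom.ExcludedMiddle using (ExcludedMiddle)
open import Axiom.DoubleNegationElimination using (em⇒dne)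
open import Data.Nat as ℕ using (ℕ; zero; suc; _+_)
import Data.Nat.Properties as ℕₚ
open import Data.Nat.Induction using (<-wellFounded)
open import Data.List using ([]; _∷_; _++_; length)
open import Data.List.Properties using (++-assoc; length-++)
open import Data.List.Relation.Unary.Any using (Any; here; there)
open import Data.List.Relation.Unary.Any.Properties using (++⁺ˡ; ++⁺ʳ)
open import Data.Product using (Σ; ∃; _×_; _,_; proj₁; proj₂)
open import Data.Sum using (_⊎_; inj₁; inj₂)
open import Data.Unit using (⊤; tt)
open import Data.Empty using (⊥; ⊥-elim)
open import Function using (_∘_)
open import Induction.WellFounded using (WellFounded; Acc; acc)
open import Relation.Nullary using (¬_; yes; no)
open import Relation.Nullary.Decidable using (True; toWitness; fromWitness)
open import Relation.Binary using (Rel; Reflexive; Transitive; IsStrictTotalOrder; tri<; tri≈; tri>)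
import Relation.Binary.Construct.On as On
open import Relation.Binary.PropositionalEquality using (_≡_; _≢_; refl; sym; trans; cong; subst)
open import Relation.Unary using (Pred; _⊆_; _∪_)

module Classical (em : ∀ {p} → ExcludedMiddle p) where

  dne : ∀ {p} {A : Set p} → ¬ ¬ A → A
  dne = em⇒dne em

  minimal : ∀ {a r p} {A : Set a} {_≺_ : Rel A r} → WellFounded _≺_ →
            {P : Pred A p} → ∃ P → ∃ λ x → P x × ∀ y → P y → ¬ y ≺ x
  minimal {_≺_ = _≺_} wf {P} (x , Px) = go x (wf x) Px
    where
      go : ∀ x → Acc _≺_ x → P x → ∃ λ x → P x × ∀ y → P y → ¬ y ≺ x
      go x (acc rs) Px with em {P = ∃ λ y → P y × y ≺ x}
      ... | yes (y , Py , y≺x) = go y (rs y≺x) Py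
      ... | no none = x , Px , λ y Py y≺x → none (y , Py , y≺x)

module Dominance {a ℓ} {P : Set a} {_≤_ : Rel P ℓ}
                 (≤-refl : Reflexive _≤_) (≤-trans : Transitive _≤_)
                 (em : ∀ {p} → ExcludedMiddle p) where

  open Classical em
  open OrderNotions P _≤_

  P̂ : Set (a ⊔ lsuc ℓ)
  P̂ = Σ (Pred P ℓ) IsIrreducible

  _⊆̂_ : Rel P̂ (a ⊔ ℓ)
  A ⊆̂ B = proj₁ A ⊆ proj₁ B

  module P̂ = OrderNotions P̂ _⊆̂_

  Γ̂ : Set (lsuc (a ⊔ lsuc ℓ))
  Γ̂ = P̂.Γ (a ⊔ lsuc ℓ)

  _⊑Γ̂_ : Rel Γ̂ (a ⊔ lsuc ℓ)
  _⊑Γ̂_ = P̂._⊑Γ_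

  -- Excluded middle makes every proposition equivalent to one in Set; this is
  -- how closures and preimages of large families land back in Pred P ℓ.
  Resize : ∀ {b} → Set b → Set ℓ
  Resize B = Lift ℓ (True (em {P = B}))

  resize : ∀ {b} {B : Set b} → B → Resize B
  resize = lift ∘ fromWitness

  unresize : ∀ {b} {B : Set b} → Resize B → B
  unresize = toWitness ∘ lower

  ↓_ : P → Pred P ℓ
  ↓ x = _≤ x

  ↓⊆ : ∀ {C : Pred P ℓ} {x} → IsScottClosed C → C x → ↓ x ⊆ C
  ↓⊆ (isLower , _) Cx y≤x = isLower _ _ y≤x Cx

  ↓-isScottClosed : ∀ x → IsScottClosed (↓ x)
  ↓-isScottClosed x =
    (λ _ _ y≤z z≤x → ≤-trans y≤z z≤x) , λ _ _ D⊆↓x _ (_ , least) → least x (λ _ → D⊆↓x)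

  ↓-isIrreducible : ∀ x → IsIrreducible (↓ x)
  ↓-isIrreducible x = ↓-isScottClosed x , (x , ≤-refl) , split
    where
      split : ∀ (C C′ : Γ ℓ) → ↓ x ⊆ proj₁ C ∪ proj₁ C′ → ↓ x ⊆ proj₁ C ⊎ ↓ x ⊆ proj₁ C′
      split (C , C-closed) (C′ , C′-closed) ↓x⊆ with ↓x⊆ ≤-refl
      ... | inj₁ Cx = inj₁ (↓⊆ C-closed Cx)
      ... | inj₂ C′x = inj₂ (↓⊆ C′-closed C′x)

  η : P → P̂
  η x = ↓ x , ↓-isIrreducible x

  closure : ∀ {b} → Pred P b → Pred P ℓ
  closure U x = Resize (∀ (C : Γ ℓ) → U ⊆ proj₁ C → proj₁ C x)

  ⊆-closure : ∀ {b} {U : Pred P b} → U ⊆ closure U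
  ⊆-closure Ux = resize λ _ U⊆C → U⊆C Ux

  closure-least : ∀ {b} {U : Pred P b} (C : Γ ℓ) → U ⊆ proj₁ C → closure U ⊆ proj₁ C
  closure-least C U⊆C x∈ = unresize x∈ C U⊆C

  closure-isScottClosed : ∀ {b} (U : Pred P b) → IsScottClosed (closure U)
  closure-isScottClosed U =
    (λ x y x≤y y∈ → resize λ C U⊆C → proj₁ (proj₂ C) x y x≤y (unresize y∈ C U⊆C)) ,
    (λ D D-directed D⊆ s s-sup → resize λ C U⊆C →
       proj₂ (proj₂ C) D D-directed (λ d∈ → unresize (D⊆ d∈) C U⊆C) s s-sup)

  ⋃̂ : ∀ {b} → Pred P̂ b → Pred P (a ⊔ lsuc ℓ ⊔ b)
  ⋃̂ 𝒟 x = ∃ λ B → 𝒟 B × proj₁ B x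

  -- A directed family cannot be split between the two halves of a cover,
  -- since any two of its members lie in a common irreducible member.
  closure-⋃̂-isIrreducible : ∀ {b} {𝒟 : Pred P̂ b} → P̂.Directed 𝒟 →
                             IsIrreducible (closure (⋃̂ 𝒟))
  closure-⋃̂-isIrreducible {𝒟 = 𝒟} ((B₀ , B₀∈𝒟) , directed) =
    closure-isScottClosed (⋃̂ 𝒟) , (x₀ , ⊆-closure (B₀ , B₀∈𝒟 , B₀x₀)) , split
    where
      open Σ (proj₁ (proj₂ (proj₂ B₀))) renaming (proj₁ to x₀; proj₂ to B₀x₀)

      split : ∀ (C C′ : Γ ℓ) → closure (⋃̂ 𝒟) ⊆ proj₁ C ∪ proj₁ C′ →
              closure (⋃̂ 𝒟) ⊆ proj₁ C ⊎ closure (⋃̂ 𝒟) ⊆ proj₁ C′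
      split C C′ cover with em {P = ∃ λ B → 𝒟 B × ¬ (proj₁ B ⊆ proj₁ C′)}
      ... | yes (B₁ , B₁∈𝒟 , B₁⊈C′) = inj₁ (closure-least C λ (B , B∈𝒟 , Bx) → member⊆C B∈𝒟 Bx)
        where
          member⊆C : ∀ {B} → 𝒟 B → proj₁ B ⊆ proj₁ C
          member⊆C {B} B∈𝒟 with directed B₁ B B₁∈𝒟 B∈𝒟
          ... | B₂ , B₂∈𝒟 , B₁⊆B₂ , B⊆B₂
              with proj₂ (proj₂ (proj₂ B₂)) C C′ (λ B₂x → cover (⊆-closure (B₂ , B₂∈𝒟 , B₂x)))
          ... | inj₁ B₂⊆C = B₂⊆C ∘ B⊆B₂
          ... | inj₂ B₂⊆C′ = ⊥-elim (B₁⊈C′ (B₂⊆C′ ∘ B₁⊆B₂))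
      ... | no none =
        inj₂ (closure-least C′ λ (B , B∈𝒟 , Bx) → dne (λ B⊈C′ → none (B , B∈𝒟 , B⊈C′)) Bx)

  irreduciblesIn : Γ ℓ → Γ̂
  irreduciblesIn (C , C-closed) = Inside , isLower , isClosed
    where
      Inside : Pred P̂ (a ⊔ lsuc ℓ)
      Inside A = Lift (lsuc ℓ) (proj₁ A ⊆ C)

      isLower : P̂.LowerSet Inside
      isLower _ _ A⊆B (lift B⊆C) = lift (B⊆C ∘ A⊆B)

      isClosed : ∀ 𝒟 → P̂.Directed 𝒟 → 𝒟 ⊆ Inside → ∀ S → P̂.IsSup 𝒟 S → Inside S
      isClosed 𝒟 𝒟-directed 𝒟⊆ S (_ , least) = lift (closure-least (C , C-closed) ⋃̂𝒟⊆C ∘ S⊆closure)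
        where
          ⋃̂𝒟⊆C : ⋃̂ 𝒟 ⊆ C
          ⋃̂𝒟⊆C (B , B∈𝒟 , Bx) = lower (𝒟⊆ B∈𝒟) Bx
          S⊆closure : proj₁ S ⊆ closure (⋃̂ 𝒟)
          S⊆closure = least (closure (⋃̂ 𝒟) , closure-⋃̂-isIrreducible 𝒟-directed)
                            (λ B B∈𝒟 Bx → ⊆-closure (B , B∈𝒟 , Bx))

  η[_]↓ : ∀ {b} → Pred P b → Pred P̂ (a ⊔ lsuc ℓ ⊔ b)
  η[ D ]↓ B = Lift (lsuc ℓ) (∃ λ d → D d × B ⊆̂ η d)

  η[]↓-directed : ∀ {D : Pred P ℓ} → Directed D → P̂.Directed η[ D ]↓
  η[]↓-directed {D} ((d₀ , d₀∈D) , directed) = (η d₀ , lift (d₀ , d₀∈D , λ y≤d₀ → y≤d₀)) , bound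
    where
      bound : ∀ B B′ → η[ D ]↓ B → η[ D ]↓ B′ → ∃ λ B″ → η[ D ]↓ B″ × B ⊆̂ B″ × B′ ⊆̂ B″
      bound B B′ (lift (d , d∈D , B⊆↓d)) (lift (d′ , d′∈D , B′⊆↓d′))
        with directed d d′ d∈D d′∈D
      ... | d″ , d″∈D , d≤d″ , d′≤d″ =
        η d″ , lift (d″ , d″∈D , λ y≤d″ → y≤d″) ,
        (λ By → ≤-trans (B⊆↓d By) d≤d″) , (λ B′y → ≤-trans (B′⊆↓d′ B′y) d′≤d″)

  η-preserves-sup : ∀ {D : Pred P ℓ} {s} → Directed D → IsSup D s → P̂.IsSup η[ D ]↓ (η s)
  η-preserves-sup {D} {s} D-directed (s-ub , s-least) = ub , least
    where
      ub : P̂.IsUpperBound η[ D ]↓ (η s)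
      ub B (lift (d , d∈D , B⊆↓d)) By = ≤-trans (B⊆↓d By) (s-ub d d∈D)

      least : ∀ T → P̂.IsUpperBound η[ D ]↓ T → η s ⊆̂ T
      least (T , T-closed , _) T-ub =
        ↓⊆ T-closed (proj₂ T-closed D D-directed D⊆T s (s-ub , s-least))
        where
          D⊆T : D ⊆ T
          D⊆T {d} d∈D = T-ub (η d) (lift (d , d∈D , λ y≤d → y≤d)) ≤-refl

  pointsOf : Γ̂ → Γ ℓ
  pointsOf (𝒜 , 𝒜-lower , 𝒜-closed) = (λ x → Resize (𝒜 (η x))) , isLower , isClosed
    where
      isLower : LowerSet (λ x → Resize (𝒜 (η x)))
      isLower x y x≤y ηy∈ = resize (𝒜-lower (η x) (η y) (λ z≤x → ≤-trans z≤x x≤y) (unresize ηy∈))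

      isClosed : ∀ D → Directed D → D ⊆ (λ x → Resize (𝒜 (η x))) →
                 ∀ s → IsSup D s → Resize (𝒜 (η s))
      isClosed D D-directed D⊆ s s-sup =
        resize (𝒜-closed η[ D ]↓ (η[]↓-directed D-directed) η[D]↓⊆𝒜
                         (η s) (η-preserves-sup D-directed s-sup))
        where
          η[D]↓⊆𝒜 : η[ D ]↓ ⊆ 𝒜
          η[D]↓⊆𝒜 {B} (lift (d , d∈D , B⊆↓d)) = 𝒜-lower B (η d) B⊆↓d (unresize (D⊆ d∈D))

  Dominated : Set (lsuc (a ⊔ lsuc ℓ))
  Dominated = ∀ (𝒜 : Γ̂) (A : P̂) → (∀ {x} → proj₁ A x → proj₁ 𝒜 (η x)) → proj₁ 𝒜 A

  dominated⇒Γ≅Γ̂ : Dominated → OrderIso (Γ ℓ) _⊑Γ_ Γ̂ _⊑Γ̂_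
  dominated⇒Γ≅Γ̂ dominated = record
    { to        = irreduciblesIn
    ; from      = pointsOf
    ; to-mono   = λ C⊆C′ (lift A⊆C) → lift (C⊆C′ ∘ A⊆C)
    ; from-mono = λ 𝒜⊆ℬ ηx∈𝒜 → resize (𝒜⊆ℬ (unresize ηx∈𝒜))
    ; from-to   = λ C → (λ ηx⊆C → lower (unresize ηx⊆C) ≤-refl) ,
                        (λ Cx → resize (lift λ {y} → ↓⊆ (proj₂ C) Cx {y}))
    ; to-from   = λ 𝒜 → (λ {A} (lift A⊆) → dominated 𝒜 A (unresize ∘ A⊆)) ,
                        (λ {A} 𝒜A → lift λ Ax →
                           resize (proj₁ (proj₂ 𝒜) _ A (↓⊆ (proj₁ (proj₂ A)) Ax) 𝒜A))
    }

module Omega1Properties (Ω : Omega1) (em : ∀ {p} → ExcludedMiddle p) where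

  open Classical em
  open Construction Ω using (W; _<_; isSTO; wf; uncountable; segmentsCountable; _≤W_)
  open IsStrictTotalOrder isSTO using (compare) renaming (trans to <-trans; irrefl to <-irreflexive)

  <-irrefl : ∀ {x} → ¬ x < x
  <-irrefl = <-irreflexive refl

  ≤W-refl : ∀ {x} → x ≤W x
  ≤W-refl = inj₂ refl

  <-≤W-trans : ∀ {x y z} → x < y → y ≤W z → x < z
  <-≤W-trans x<y (inj₁ y<z) = <-trans x<y y<z
  <-≤W-trans x<y (inj₂ refl) = x<y

  ≤W-<-trans : ∀ {x y z} → x ≤W y → y < z → x < z
  ≤W-<-trans (inj₁ x<y) y<z = <-trans x<y y<z
  ≤W-<-trans (inj₂ refl) y<z = y<z

  ≤W-trans : ∀ {x y z} → x ≤W y → y ≤W z → x ≤W z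
  ≤W-trans x≤y (inj₁ y<z) = inj₁ (≤W-<-trans x≤y y<z)
  ≤W-trans x≤y (inj₂ refl) = x≤y

  <⇒≱ : ∀ {x y} → x < y → ¬ y ≤W x
  <⇒≱ x<y y≤x = <-irrefl (<-≤W-trans x<y y≤x)

  ≤W-antisym : ∀ {x y} → x ≤W y → y ≤W x → x ≡ y
  ≤W-antisym (inj₁ x<y) y≤x = ⊥-elim (<⇒≱ x<y y≤x)
  ≤W-antisym (inj₂ x≡y) _ = x≡y

  ≤W-or-> : ∀ x y → x ≤W y ⊎ y < x
  ≤W-or-> x y with compare x y
  ... | tri< x<y _ _ = inj₁ (inj₁ x<y)
  ... | tri≈ _ x≡y _ = inj₁ (inj₂ x≡y)
  ... | tri> _ _ y<x = inj₂ y<x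

  ≮⇒≥ : ∀ {x y} → ¬ x < y → y ≤W x
  ≮⇒≥ {x} {y} x≮y with ≤W-or-> y x
  ... | inj₁ y≤x = y≤x
  ... | inj₂ x<y = ⊥-elim (x≮y x<y)

  W-inhabited : W
  W-inhabited = dne λ ¬W → uncountable ((λ _ → zero) , λ x → ⊥-elim (¬W x))

  -- A largest ordinal x would make W = [0, x] countable, as [0, x) is.
  W-unbounded : ∀ x → ∃ (x <_)
  W-unbounded x = dne λ x-max → uncountable (code x-max , code-injective x-max)
    where
      open Σ (segmentsCountable x) renaming (proj₁ to g; proj₂ to g-injective)

      code : ¬ ∃ (x <_) → W → ℕ
      code x-max y with compare y x
      ... | tri< y<x _ _ = suc (g (y , y<x))
      ... | tri≈ _ _ _ = zero
      ... | tri> _ _ x<y = ⊥-elim (x-max (y , x<y))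

      code-injective : ∀ x-max y z → code x-max y ≡ code x-max z → y ≡ z
      code-injective x-max y z eq with compare y x | compare z x
      ... | tri< y<x _ _ | tri< z<x _ _ = g-injective (y , y<x) (z , z<x) (ℕₚ.suc-injective eq)
      ... | tri≈ _ y≡x _ | tri≈ _ z≡x _ = trans y≡x (sym z≡x)
      ... | tri> _ _ x<y | _            = ⊥-elim (x-max (y , x<y))
      ... | tri< _ _ _   | tri> _ _ x<z = ⊥-elim (x-max (z , x<z))
      ... | tri≈ _ _ _   | tri> _ _ x<z = ⊥-elim (x-max (z , x<z))

  above₂ : ∀ x y → ∃ λ z → x < z × y < z
  above₂ x y with ≤W-or-> x y
  ... | inj₁ x≤y = let z , y<z = W-unbounded y in z , ≤W-<-trans x≤y y<z , y<z
  ... | inj₂ y<x = let z , x<z = W-unbounded x in z , x<z , <-trans y<x x<z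

  W-least : ∀ {p} {P : Pred W p} → ∃ P → ∃ λ w → P w × ∀ v → P v → w ≤W v
  W-least ∃P with minimal wf ∃P
  ... | w , Pw , minimum = w , Pw , λ v Pv → ≮⇒≥ (minimum v Pv)

  Unbounded : ∀ {p} → Pred W p → Set p
  Unbounded V = ∀ x → ∃ λ v → V v × x < v

  Limit : W → Set
  Limit w = ∃ (_< w) × ∀ u → u < w → ∃ λ v → u < v × v < w

  ¬unbounded⇒bounded : ∀ {p} {V : Pred W p} → ¬ Unbounded V → ∃ λ β → ∀ v → V v → v ≤W β
  ¬unbounded⇒bounded ¬unbounded =
    dne λ no-bound → ¬unbounded λ x → dne λ nothing-above →
      no-bound (x , λ v Vv → ≮⇒≥ λ x<v → nothing-above (v , Vv , x<v))

  unbounded-∪ : ∀ {p q} {V : Pred W p} {V′ : Pred W q} →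
                (∀ m → V m ⊎ V′ m) → Unbounded V ⊎ Unbounded V′
  unbounded-∪ {V = V} {V′} cover with em {P = Unbounded V}
  ... | yes V-unbounded = inj₁ V-unbounded
  ... | no ¬V-unbounded = inj₂ λ x → V′-above x (above₂ x β)
    where
      open Σ (¬unbounded⇒bounded ¬V-unbounded) renaming (proj₁ to β; proj₂ to V≤β)
      V′-above : ∀ x → (∃ λ m → x < m × β < m) → ∃ λ m → V′ m × x < m
      V′-above x (m , x<m , β<m) with cover m
      ... | inj₁ Vm = ⊥-elim (<⇒≱ β<m (V≤β m Vm))
      ... | inj₂ V′m = m , V′m , x<m

  data SupShape {p} (V : Pred W p) : Set p where
    unbounded : Unbounded V → SupShape V
    maximum   : ∀ {w} → V w → (∀ v → V v → v ≤W w) → SupShape V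
    limit     : ∀ {w} → Limit w → (∀ v → V v → v < w) →
                (∀ u → u < w → ∃ λ v → V v × u < v) → SupShape V

  supShape : ∀ {p} {V : Pred W p} → ∃ V → SupShape V
  supShape {V = V} (v₀ , Vv₀) with em {P = Unbounded V}
  ... | yes V-unbounded = unbounded V-unbounded
  ... | no ¬V-unbounded with W-least (¬unbounded⇒bounded ¬V-unbounded)
  ...   | w , V≤w , w-least with em {P = V w}
  ...     | yes Vw = maximum Vw V≤w
  ...     | no ¬Vw = limit ((v₀ , V<w v₀ Vv₀) , w-limit) V<w cofinal
    where
      V<w : ∀ v → V v → v < w
      V<w v Vv with V≤w v Vv
      ... | inj₁ v<w = v<w
      ... | inj₂ refl = ⊥-elim (¬Vw Vv)

      cofinal : ∀ u → u < w → ∃ λ v → V v × u < v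
      cofinal u u<w = dne λ nothing-above →
        <⇒≱ u<w (w-least u λ v Vv → ≮⇒≥ λ u<v → nothing-above (v , Vv , u<v))

      w-limit : ∀ u → u < w → ∃ λ v → u < v × v < w
      w-limit u u<w = let v , Vv , u<v = cofinal u u<w in v , u<v , V<w v Vv

  limit-above : ∀ {w} → Limit w → ∀ m → ∃ λ u → u < w × (m < w → m < u)
  limit-above ((u₀ , u₀<w) , w-limit) m with ≤W-or-> _ m
  ... | inj₁ w≤m = u₀ , u₀<w , λ m<w → ⊥-elim (<⇒≱ m<w w≤m)
  ... | inj₂ m<w = let u , m<u , u<w = w-limit m m<w in u , u<w , λ _ → m<u

module ZProperties (Ω : Omega1) (em : ∀ {p} → ExcludedMiddle p) where

  open Classical em
  open Omega1Properties Ω em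
  open Construction Ω
  open IsStrictTotalOrder isSTO using (compare)

  min2≤ˡ : ∀ x y → min2 x y ≤W x
  min2≤ˡ x y with compare x y
  ... | tri< _ _ _ = ≤W-refl
  ... | tri≈ _ _ _ = ≤W-refl
  ... | tri> _ _ y<x = inj₁ y<x

  min2≤ʳ : ∀ x y → min2 x y ≤W y
  min2≤ʳ x y with compare x y
  ... | tri< x<y _ _ = inj₁ x<y
  ... | tri≈ _ x≡y _ = inj₂ x≡y
  ... | tri> _ _ _ = ≤W-refl

  min2-sel : ∀ x y → min2 x y ≡ x ⊎ min2 x y ≡ y
  min2-sel x y with compare x y
  ... | tri< _ _ _ = inj₁ refl
  ... | tri≈ _ _ _ = inj₁ refl
  ... | tri> _ _ _ = inj₂ refl

  any≤⇒minL≤ : ∀ {m} u t → Any (_≤W m) (u ∷ t) → minL u t ≤W m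
  any≤⇒minL≤ u []      (here u≤m)  = u≤m
  any≤⇒minL≤ u (v ∷ t) (here u≤m)  = ≤W-trans (min2≤ˡ u (minL v t)) u≤m
  any≤⇒minL≤ u (v ∷ t) (there any) = ≤W-trans (min2≤ʳ u (minL v t)) (any≤⇒minL≤ v t any)

  minL≤⇒any≤ : ∀ {m} u t → minL u t ≤W m → Any (_≤W m) (u ∷ t)
  minL≤⇒any≤ u []      min≤m = here min≤m
  minL≤⇒any≤ u (v ∷ t) min≤m with min2-sel u (minL v t)
  ... | inj₁ eq = here (subst (_≤W _) eq min≤m)
  ... | inj₂ eq = there (minL≤⇒any≤ v t (subst (_≤W _) eq min≤m))

  data _≤ₛ_ : Rel W* 0ℓ where
    []≤ₛ[] : [] ≤ₛ []
    head≤  : ∀ {u v ρ} → u ≤W v → (u ∷ ρ) ≤ₛ (v ∷ ρ)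

  ≤ₛ-refl : ∀ {σ} → σ ≤ₛ σ
  ≤ₛ-refl {[]}    = []≤ₛ[]
  ≤ₛ-refl {_ ∷ _} = head≤ ≤W-refl

  ≤ₛ-trans : ∀ {σ τ π} → σ ≤ₛ τ → τ ≤ₛ π → σ ≤ₛ π
  ≤ₛ-trans []≤ₛ[]      []≤ₛ[]      = []≤ₛ[]
  ≤ₛ-trans (head≤ u≤v) (head≤ v≤w) = head≤ (≤W-trans u≤v v≤w)

  ≤ₛ-length : ∀ {σ τ} → σ ≤ₛ τ → length σ ≡ length τ
  ≤ₛ-length []≤ₛ[]    = refl
  ≤ₛ-length (head≤ _) = refl

  ≤ₛ⇒≡⊎<₁ : ∀ {σ τ} → σ ≤ₛ τ → σ ≡ τ ⊎ (∀ {m} → (m , σ) <₁ (m , τ))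
  ≤ₛ⇒≡⊎<₁ []≤ₛ[]              = inj₁ refl
  ≤ₛ⇒≡⊎<₁ (head≤ (inj₁ u<v))  = inj₂ (lt₁ u<v)
  ≤ₛ⇒≡⊎<₁ (head≤ (inj₂ refl)) = inj₁ refl

  Reaches : W → W → W* → Set
  Reaches k m t = k ≡ m ⊎ Any (_≤W m) t

  -- Normal form of ≤Z: (k , t ++ σ) ≼ (m , τ) drops the prefix t by a <₂ step
  -- (k = m) or a <₃ step (a letter of t is ≤ m), or by no step if t is empty,
  -- and then takes at most one <₁ step σ ≤ₛ τ.
  record _≼_ (x y : Z) : Set where
    constructor ≼-intro
    field
      prefix  : W*
      rest    : W*
      split   : proj₂ x ≡ prefix ++ rest
      sibling : rest ≤ₛ proj₂ y
      reach   : Reaches (proj₁ x) (proj₁ y) prefix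

  ≼-refl : ∀ {x} → x ≼ x
  ≼-refl = ≼-intro [] _ refl ≤ₛ-refl (inj₁ refl)

  reaches-[] : ∀ {k m n t} → Reaches k m t → Reaches m n [] → Reaches k n t
  reaches-[] reach (inj₁ refl) = reach

  reaches-∷ : ∀ {k m n u v} t₁ t₂ → v ≤W u → Reaches k m t₁ → Reaches m n (u ∷ t₂) →
              Reaches k n (t₁ ++ v ∷ t₂)
  reaches-∷ t₁ t₂ v≤u (inj₁ refl) (inj₁ refl)          = inj₁ refl
  reaches-∷ t₁ t₂ v≤u (inj₂ any)  (inj₁ refl)          = inj₂ (++⁺ˡ any)
  reaches-∷ t₁ t₂ v≤u _           (inj₂ (here u≤n))    = inj₂ (++⁺ʳ t₁ (here (≤W-trans v≤u u≤n)))
  reaches-∷ t₁ t₂ v≤u _           (inj₂ (there any))   = inj₂ (++⁺ʳ t₁ (there any))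

  ≼-trans : ∀ {x y z} → x ≼ y → y ≼ z → x ≼ z
  ≼-trans (≼-intro t₁ σ₁ refl s₁ c₁) (≼-intro [] σ₂ refl s₂ c₂) =
    ≼-intro t₁ σ₁ refl (≤ₛ-trans s₁ s₂) (reaches-[] c₁ c₂)
  ≼-trans (≼-intro t₁ (v ∷ _) refl (head≤ v≤u) c₁) (≼-intro (u ∷ t₂) σ₂ refl s₂ c₂) =
    ≼-intro (t₁ ++ v ∷ t₂) σ₂ (sym (++-assoc t₁ (v ∷ t₂) σ₂)) s₂ (reaches-∷ t₁ t₂ v≤u c₁ c₂)

  drop-prefix : ∀ {k m} u t σ → Reaches k m (u ∷ t) →
                (k , (u ∷ t) ++ σ) <₂ (m , σ) ⊎ (k , (u ∷ t) ++ σ) <₃ (m , σ)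
  drop-prefix u t σ (inj₁ refl) = inj₁ (lt₂ (u ∷ t) σ λ ())
  drop-prefix u t σ (inj₂ any)  = inj₂ (lt₃ u t σ (any≤⇒minL≤ u t any))

  ≼⇒≤Z : ∀ {x y} → x ≼ y → x ≤Z y
  ≼⇒≤Z (≼-intro [] σ refl s (inj₁ refl)) with ≤ₛ⇒≡⊎<₁ s
  ... | inj₁ refl    = inj₂ refl
  ... | inj₂ <₁-step = inj₁ (inj₁ <₁-step)
  ≼⇒≤Z (≼-intro (u ∷ t) σ refl s reach) with ≤ₛ⇒≡⊎<₁ s | drop-prefix u t σ reach
  ... | inj₁ refl    | inj₁ <₂-step = inj₁ (inj₂ (inj₁ <₂-step))
  ... | inj₁ refl    | inj₂ <₃-step = inj₁ (inj₂ (inj₂ (inj₁ <₃-step)))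
  ... | inj₂ <₁-step | inj₁ <₂-step = inj₁ (inj₂ (inj₂ (inj₂ (inj₁ (_ , <₂-step , <₁-step)))))
  ... | inj₂ <₁-step | inj₂ <₃-step = inj₁ (inj₂ (inj₂ (inj₂ (inj₂ (_ , <₃-step , <₁-step)))))

  ≤Z⇒≼ : ∀ {x y} → x ≤Z y → x ≼ y
  ≤Z⇒≼ (inj₂ refl) = ≼-refl
  ≤Z⇒≼ (inj₁ (inj₁ (lt₁ u<v))) = ≼-intro [] _ refl (head≤ (inj₁ u<v)) (inj₁ refl)
  ≤Z⇒≼ (inj₁ (inj₂ (inj₁ (lt₂ t s _)))) = ≼-intro t s refl ≤ₛ-refl (inj₁ refl)
  ≤Z⇒≼ (inj₁ (inj₂ (inj₂ (inj₁ (lt₃ u t s min≤m))))) =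
    ≼-intro (u ∷ t) s refl ≤ₛ-refl (inj₂ (minL≤⇒any≤ u t min≤m))
  ≤Z⇒≼ (inj₁ (inj₂ (inj₂ (inj₂ (inj₁ (_ , lt₂ t s _ , lt₁ u<v)))))) =
    ≼-intro t _ refl (head≤ (inj₁ u<v)) (inj₁ refl)
  ≤Z⇒≼ (inj₁ (inj₂ (inj₂ (inj₂ (inj₂ (_ , lt₃ u t s min≤m , lt₁ u<v)))))) =
    ≼-intro (u ∷ t) _ refl (head≤ (inj₁ u<v)) (inj₂ (minL≤⇒any≤ u t min≤m))

  ≤Z-refl : ∀ {x} → x ≤Z x
  ≤Z-refl = inj₂ refl

  ≤Z-trans : ∀ {x y z} → x ≤Z y → y ≤Z z → x ≤Z z
  ≤Z-trans x≤y y≤z = ≼⇒≤Z (≼-trans (≤Z⇒≼ x≤y) (≤Z⇒≼ y≤z))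

  sibling≼ : ∀ {k u v r} → u ≤W v → (k , u ∷ r) ≼ (k , v ∷ r)
  sibling≼ u≤v = ≼-intro [] _ refl (head≤ u≤v) (inj₁ refl)

  ∷≼ : ∀ {k u r} → (k , u ∷ r) ≼ (k , r)
  ∷≼ {u = u} = ≼-intro (u ∷ []) _ refl ≤ₛ-refl (inj₁ refl)

  letter≼ : ∀ {k m u r} → u ≤W m → (k , u ∷ r) ≼ (m , r)
  letter≼ {u = u} u≤m = ≼-intro (u ∷ []) _ refl ≤ₛ-refl (inj₂ (here u≤m))

  ≼-sameLength : ∀ {k q m τ} → (k , q) ≼ (m , τ) → length q ℕ.≤ length τ → k ≡ m × q ≤ₛ τ
  ≼-sameLength (≼-intro [] _ refl s (inj₁ k≡m)) _ = k≡m , s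
  ≼-sameLength {τ = τ} (≼-intro (u ∷ t) σ refl s _) q≤τ = ⊥-elim (ℕₚ.<-irrefl refl τ<τ)
    where
      open ℕₚ.≤-Reasoning
      τ<τ : length τ ℕ.< length τ
      τ<τ = begin-strict
        length τ              ≡⟨ sym (≤ₛ-length s) ⟩
        length σ              ≤⟨ ℕₚ.m≤n+m (length σ) (length t) ⟩
        length t + length σ   ≡⟨ sym (length-++ t) ⟩
        length (t ++ σ)       <⟨ ℕₚ.n<1+n _ ⟩
        length ((u ∷ t) ++ σ) ≤⟨ q≤τ ⟩
        length τ              ∎

  ≼-sibling-head : ∀ {k v m u r} → (k , v ∷ r) ≼ (m , u ∷ r) → v ≤W u
  ≼-sibling-head v∷r≼ with ≼-sameLength v∷r≼ ℕₚ.≤-refl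
  ... | _ , head≤ v≤u = v≤u

  _⊑_ : Rel W* 0ℓ
  q ⊑ τ = ∀ k → (k , q) ≼ (k , τ)

  ≼⇒⊑ : ∀ {k q m τ} → (k , q) ≼ (m , τ) → q ⊑ τ
  ≼⇒⊑ (≼-intro t σ split s _) _ = ≼-intro t σ split s (inj₁ refl)

  ⊑-refl : ∀ {q} → q ⊑ q
  ⊑-refl _ = ≼-refl

  ⊑-trans : ∀ {q τ π} → q ⊑ τ → τ ⊑ π → q ⊑ π
  ⊑-trans q⊑τ τ⊑π k = ≼-trans (q⊑τ k) (τ⊑π k)

  sibling⊑ : ∀ {u v r} → u ≤W v → (u ∷ r) ⊑ (v ∷ r)
  sibling⊑ u≤v _ = sibling≼ u≤v

  ∷⊑ : ∀ {u r} → (u ∷ r) ⊑ r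
  ∷⊑ _ = ∷≼

  ⊑-uncons : ∀ {u r τ} → (u ∷ r) ⊑ τ → r ⊑ τ ⊎ ∃ λ u′ → τ ≡ u′ ∷ r × u ≤W u′
  ⊑-uncons u∷r⊑τ with u∷r⊑τ W-inhabited
  ... | ≼-intro []      _ refl (head≤ u≤u′) _ = inj₂ (_ , refl , u≤u′)
  ... | ≼-intro (_ ∷ t) σ refl s            _ = inj₁ λ _ → ≼-intro t σ refl s (inj₁ refl)

  -- In the last case the letter u is dropped by a <₃ step of its own, so it
  -- may be replaced by any letter v ≤ m.
  ≼-uncons : ∀ {k u r m τ} → (k , u ∷ r) ≼ (m , τ) →
               (k , r) ≼ (m , τ)
             ⊎ (k ≡ m × ∃ λ u′ → τ ≡ u′ ∷ r × u ≤W u′)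
             ⊎ (u ≤W m × ∀ j v → v ≤W m → (j , v ∷ r) ≼ (m , τ))
  ≼-uncons (≼-intro [] _ refl (head≤ u≤u′) (inj₁ k≡m)) = inj₂ (inj₁ (k≡m , _ , refl , u≤u′))
  ≼-uncons (≼-intro (_ ∷ t) σ refl s (inj₁ k≡m))        = inj₁ (≼-intro t σ refl s (inj₁ k≡m))
  ≼-uncons (≼-intro (_ ∷ t) σ refl s (inj₂ (there any))) = inj₁ (≼-intro t σ refl s (inj₂ any))
  ≼-uncons (≼-intro (_ ∷ t) σ refl s (inj₂ (here u≤m))) =
    inj₂ (inj₂ (u≤m , λ _ v v≤m → ≼-intro (v ∷ t) σ refl s (inj₂ (here v≤m))))

  ≼-raise : ∀ {k u w r m τ} → u < w → (k , u ∷ r) ≼ (m , τ) →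
              (k , w ∷ r) ≼ (m , τ)
            ⊎ (k ≡ m × ∃ λ u′ → τ ≡ u′ ∷ r × u′ < w)
            ⊎ (u ≤W m × m < w × ∀ j → (j , u ∷ r) ≼ (m , τ))
  ≼-raise {u = u} {w} {m = m} u<w u∷r≼ with ≼-uncons u∷r≼
  ... | inj₁ r≼ = inj₁ (≼-trans ∷≼ r≼)
  ... | inj₂ (inj₁ (refl , u′ , refl , _)) with ≤W-or-> w u′
  ...   | inj₁ w≤u′ = inj₁ (sibling≼ w≤u′)
  ...   | inj₂ u′<w = inj₂ (inj₁ (refl , u′ , refl , u′<w))
  ≼-raise {u = u} {w} {m = m} u<w u∷r≼ | inj₂ (inj₂ (u≤m , consumed)) with ≤W-or-> w m
  ...   | inj₁ w≤m = inj₁ (consumed _ w w≤m)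
  ...   | inj₂ m<w = inj₂ (inj₂ (u≤m , m<w , λ j → consumed j u u≤m))

  ∷-chain-least : ∀ {k r y} → (∀ u → (k , u ∷ r) ≼ y) → (k , r) ≼ y
  ∷-chain-least {y = m , []} chain with W-unbounded m
  ... | u , m<u with ≼-uncons (chain u)
  ...   | inj₁ r≼ = r≼
  ...   | inj₂ (inj₂ (u≤m , _)) = ⊥-elim (<⇒≱ m<u u≤m)
  ∷-chain-least {y = m , v ∷ τ} chain with above₂ m v
  ... | u , m<u , v<u with ≼-uncons (chain u)
  ...   | inj₁ r≼ = r≼
  ...   | inj₂ (inj₁ (_ , _ , refl , u≤v)) = ⊥-elim (<⇒≱ v<u u≤v)
  ...   | inj₂ (inj₂ (u≤m , _)) = ⊥-elim (<⇒≱ m<u u≤m)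

  limit-chain-least : ∀ {k r w y} → Limit w → (∀ u → u < w → (k , u ∷ r) ≼ y) →
                      (k , w ∷ r) ≼ y
  limit-chain-least {y = m , _} w-limit chain with limit-above w-limit m
  ... | u , u<w , m<u-if-m<w with ≼-raise u<w (chain u u<w)
  ...   | inj₁ w∷r≼ = w∷r≼
  ...   | inj₂ (inj₂ (u≤m , m<w , _)) = ⊥-elim (<⇒≱ (m<u-if-m<w m<w) u≤m)
  ...   | inj₂ (inj₁ (_ , u′ , refl , u′<w)) =
    let v , u′<v , v<w = proj₂ w-limit u′ u′<w
    in ⊥-elim (<⇒≱ u′<v (≼-sibling-head (chain v v<w)))

  shortest : ∀ {p} {P : Pred Z p} → ∃ P →
             ∃ λ z → P z × ∀ z′ → P z′ → length (proj₂ z) ℕ.≤ length (proj₂ z′)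
  shortest ∃P with minimal (On.wellFounded (length ∘ proj₂) <-wellFounded) ∃P
  ... | z , Pz , none-shorter = z , Pz , λ z′ Pz′ → ℕₚ.≮⇒≥ (none-shorter z′ Pz′)

  record ChainClosed (C : Pred Z 0ℓ) : Set where
    field
      down      : ∀ {x y} → x ≼ y → C y → C x
      ∷-sup     : ∀ {k r} → (∀ u → C (k , u ∷ r)) → C (k , r)
      limit-sup : ∀ {k r w} → Limit w → (∀ u → u < w → C (k , u ∷ r)) → C (k , w ∷ r)

  open OrderNotions Z _≤Z_ using (Directed; IsSup; IsUpperBound)

  Chain : W → W* → Pred W 0ℓ → Pred Z 0ℓ
  Chain k r V z = ∃ λ u → V u × z ≡ (k , u ∷ r)

  chain-directed : ∀ {k r V} → ∃ V → Directed (Chain k r V)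
  chain-directed {k} {r} {V} (u₀ , Vu₀) = ((k , u₀ ∷ r) , u₀ , Vu₀ , refl) , bound
    where
      bound : ∀ x y → Chain k r V x → Chain k r V y → ∃ λ z → Chain k r V z × x ≤Z z × y ≤Z z
      bound _ _ (u , Vu , refl) (v , Vv , refl) with ≤W-or-> u v
      ... | inj₁ u≤v = (k , v ∷ r) , (v , Vv , refl) , ≼⇒≤Z (sibling≼ u≤v) , ≤Z-refl
      ... | inj₂ v<u = (k , u ∷ r) , (u , Vu , refl) , ≤Z-refl , ≼⇒≤Z (sibling≼ (inj₁ v<u))

  ∷-chain-isSup : ∀ {k r} → IsSup (Chain k r (λ _ → ⊤)) (k , r)
  ∷-chain-isSup =
    (λ { _ (_ , _ , refl) → ≼⇒≤Z ∷≼ }) ,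
    λ y y-ub → ≼⇒≤Z (∷-chain-least λ u → ≤Z⇒≼ (y-ub _ (u , tt , refl)))

  limit-chain-isSup : ∀ {k r w} → Limit w → IsSup (Chain k r (_< w)) (k , w ∷ r)
  limit-chain-isSup w-limit =
    (λ { _ (_ , u<w , refl) → ≼⇒≤Z (sibling≼ (inj₁ u<w)) }) ,
    λ y y-ub → ≼⇒≤Z (limit-chain-least w-limit λ u u<w → ≤Z⇒≼ (y-ub _ (u , u<w , refl)))

  scottClosed⇒chainClosed : ∀ {C} → IsScottClosedZ C → ChainClosed C
  scottClosed⇒chainClosed (C-lower , C-closed) = record
    { down      = λ x≼y Cy → C-lower _ _ (≼⇒≤Z x≼y) Cy
    ; ∷-sup     = λ C∷ → C-closed _ (chain-directed (W-inhabited , tt))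
                                  (λ { (u , _ , refl) → C∷ u }) _ ∷-chain-isSup
    ; limit-sup = λ w-limit C∷ → C-closed _ (chain-directed (proj₁ w-limit))
                                  (λ { (u , u<w , refl) → C∷ u u<w }) _ (limit-chain-isSup w-limit)
    }

  -- Going up never lengthens the string, so above a shortest member (m₀ , σ₀)
  -- of a directed set only the first letter of σ₀ can still grow.
  shortest-cofinal : ∀ {D : Pred Z 0ℓ} {m₀ σ₀} → Directed D → D (m₀ , σ₀) →
                     (∀ z → D z → length σ₀ ℕ.≤ length (proj₂ z)) →
                     ∀ d → D d → ∃ λ σ → D (m₀ , σ) × σ₀ ≤ₛ σ × d ≼ (m₀ , σ)
  shortest-cofinal (_ , directed) d₀∈D d₀-shortest d d∈D with directed d _ d∈D d₀∈D
  ... | (m , σ) , z∈D , d≤z , d₀≤z with ≼-sameLength (≤Z⇒≼ d₀≤z) (d₀-shortest _ z∈D)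
  ... | refl , σ₀≤σ = σ , z∈D , σ₀≤σ , ≤Z⇒≼ d≤z

  siblings-boundedIn : ∀ {C} {V : Pred W 0ℓ} {m₀ ρ} → ChainClosed C →
                       (∀ {v} → V v → C (m₀ , v ∷ ρ)) → ∃ V →
                       ∃ λ t → C t × ∀ {v} → V v → (m₀ , v ∷ ρ) ≼ t
  siblings-boundedIn {C} {V} {m₀} {ρ} C-closed V⊆C ∃V = bound (supShape ∃V)
    where
      open ChainClosed C-closed

      C-below : ∀ {u v} → u < v → V v → C (m₀ , u ∷ ρ)
      C-below u<v Vv = down (sibling≼ (inj₁ u<v)) (V⊆C Vv)

      bound : SupShape V → ∃ λ t → C t × ∀ {v} → V v → (m₀ , v ∷ ρ) ≼ t
      bound (maximum Vw V≤w) = _ , V⊆C Vw , λ Vv → sibling≼ (V≤w _ Vv)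
      bound (unbounded V-unbounded) =
        _ , ∷-sup (λ u → let _ , Vv , u<v = V-unbounded u in C-below u<v Vv) , λ _ → ∷≼
      bound (limit w-limit V<w cofinal) =
        _ , limit-sup w-limit (λ u u<w → let _ , Vv , u<v = cofinal u u<w in C-below u<v Vv) ,
        λ Vv → sibling≼ (inj₁ (V<w _ Vv))

  chainClosed⇒scottClosed : ∀ {C} → ChainClosed C → IsScottClosedZ C
  chainClosed⇒scottClosed {C} C-closed = (λ _ _ x≤y Cy → down (≤Z⇒≼ x≤y) Cy) , closed
    where
      open ChainClosed C-closed

      closed : ∀ D → Directed D → D ⊆ C → ∀ s → IsSup D s → C s
      closed D D-directed D⊆C s (_ , s-least) with shortest (proj₁ D-directed)
      ... | (m₀ , []) , d₀∈D , d₀-shortest = down (≤Z⇒≼ (s-least _ ub)) (D⊆C d₀∈D)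
        where
          ub : IsUpperBound D (m₀ , [])
          ub d d∈D with shortest-cofinal D-directed d₀∈D d₀-shortest d d∈D
          ... | _ , _ , []≤ₛ[] , d≼ = ≼⇒≤Z d≼
      ... | (m₀ , u₀ ∷ ρ) , d₀∈D , d₀-shortest
          with siblings-boundedIn {V = λ v → D (m₀ , v ∷ ρ)} C-closed D⊆C (u₀ , d₀∈D)
      ...   | t , Ct , siblings≼t = down (≤Z⇒≼ (s-least t ub)) Ct
        where
          ub : IsUpperBound D t
          ub d d∈D with shortest-cofinal D-directed d₀∈D d₀-shortest d d∈D
          ... | _ , v∈D , head≤ _ , d≼ = ≼⇒≤Z (≼-trans d≼ (siblings≼t v∈D))

  open Dominance {P = Z} {_≤_ = _≤Z_} ≤Z-refl ≤Z-trans em public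

  X : W* → Pred Z 0ℓ
  X σ (_ , q) = q ⊑ σ

  X-chainClosed : ∀ σ → ChainClosed (X σ)
  X-chainClosed σ = record
    { down      = λ x≼y τ⊑σ → ⊑-trans (≼⇒⊑ x≼y) τ⊑σ
    ; ∷-sup     = λ u∷r⊑σ k → ∷-chain-least λ u → u∷r⊑σ u k
    ; limit-sup = λ w-limit u∷r⊑σ k → limit-chain-least w-limit λ u u<w → u∷r⊑σ u u<w k
    }

  unbounded⇒X⊆ : ∀ {C σ} → ChainClosed C → Unbounded (λ m → C (m , σ)) → X σ ⊆ C
  unbounded⇒X⊆ C-closed C-unbounded {k , _} q⊑σ = down (q⊑σ k) (∷-sup λ v →
    let m , Cm , v<m = C-unbounded v in down (letter≼ (inj₁ v<m)) Cm)
    where open ChainClosed C-closed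

  X-isIrreducible : ∀ σ → IsIrreducibleZ (X σ)
  X-isIrreducible σ =
    chainClosed⇒scottClosed (X-chainClosed σ) , ((W-inhabited , σ) , ⊑-refl) , split
    where
      split : ∀ (C C′ : ΓZ) → X σ ⊆ proj₁ C ∪ proj₁ C′ → X σ ⊆ proj₁ C ⊎ X σ ⊆ proj₁ C′
      split (C , C-closed) (C′ , C′-closed) X⊆C∪C′
        with unbounded-∪ (λ m → X⊆C∪C′ {m , σ} ⊑-refl)
      ... | inj₁ C-unbounded  = inj₁ (unbounded⇒X⊆ (scottClosed⇒chainClosed C-closed) C-unbounded)
      ... | inj₂ C′-unbounded = inj₂ (unbounded⇒X⊆ (scottClosed⇒chainClosed C′-closed) C′-unbounded)

  X̂ : W* → P̂
  X̂ σ = X σ , X-isIrreducible σ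

  X[_∷]↓ : W* → Pred P̂ (lsuc 0ℓ)
  X[ σ ∷]↓ B = Lift (lsuc 0ℓ) (∃ λ u → B ⊆̂ X̂ (u ∷ σ))

  X∷-directed : ∀ σ → P̂.Directed X[ σ ∷]↓
  X∷-directed σ = (X̂ (W-inhabited ∷ σ) , lift (W-inhabited , λ {_} q⊑ → q⊑)) , bound
    where
      bound : ∀ B B′ → X[ σ ∷]↓ B → X[ σ ∷]↓ B′ → ∃ λ B″ → X[ σ ∷]↓ B″ × B ⊆̂ B″ × B′ ⊆̂ B″
      bound B B′ (lift (u , B⊆)) (lift (u′ , B′⊆)) with ≤W-or-> u u′
      ... | inj₁ u≤u′ = X̂ (u′ ∷ σ) , lift (u′ , λ {_} q⊑ → q⊑) ,
                        (λ Bx → ⊑-trans (B⊆ Bx) (sibling⊑ u≤u′)) , B′⊆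
      ... | inj₂ u′<u = X̂ (u ∷ σ) , lift (u , λ {_} q⊑ → q⊑) ,
                        B⊆ , (λ B′x → ⊑-trans (B′⊆ B′x) (sibling⊑ (inj₁ u′<u)))

  X-isSup : ∀ σ → P̂.IsSup X[ σ ∷]↓ (X̂ σ)
  X-isSup σ = (λ { B (lift (u , B⊆)) Bx → ⊑-trans (B⊆ Bx) ∷⊑ }) , least
    where
      least : ∀ T → P̂.IsUpperBound X[ σ ∷]↓ T → X̂ σ ⊆̂ T
      least (T , T-irreducible) T-ub {k , q} q⊑σ =
        down (q⊑σ k) (∷-sup λ u → T-ub (X̂ (u ∷ σ)) (lift (u , λ {_} q⊑ → q⊑)) ⊑-refl)
        where open ChainClosed (scottClosed⇒chainClosed (proj₁ T-irreducible))

  X̂∈ : ∀ (𝒜 : Γ̂) σ → (∀ u → proj₁ 𝒜 (η (u , σ))) → proj₁ 𝒜 (X̂ σ)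
  X̂∈ (𝒜 , 𝒜-lower , 𝒜-closed) σ η∈𝒜 =
    𝒜-closed X[ σ ∷]↓ (X∷-directed σ) X∷⊆𝒜 (X̂ σ) (X-isSup σ)
    where
      X∷⊆𝒜 : X[ σ ∷]↓ ⊆ 𝒜
      X∷⊆𝒜 {B} (lift (u , B⊆)) =
        𝒜-lower B (η (u , σ)) (λ Bx → ≼⇒≤Z (≼-trans (B⊆ Bx _) (letter≼ ≤W-refl))) (η∈𝒜 u)

  module Irreducible (A : Pred Z 0ℓ) (A-irreducible : IsIrreducibleZ A) where

    A-closed : ChainClosed A
    A-closed = scottClosed⇒chainClosed (proj₁ A-irreducible)

    open ChainClosed A-closed

    split : ∀ (C C′ : ΓZ) → A ⊆ proj₁ C ∪ proj₁ C′ → A ⊆ proj₁ C ⊎ A ⊆ proj₁ C′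
    split = proj₂ (proj₂ A-irreducible)

    Full : W* → Set
    Full σ = ∀ k → A (k , σ)

    Full-down : ∀ {q τ} → q ⊑ τ → Full τ → Full q
    Full-down q⊑τ τ-full k = down (q⊑τ k) (τ-full k)

    Maximal : Pred Z 0ℓ
    Maximal b = A b × ∀ z → A z → b ≼ z → b ≡ z

    -- Among the points of A above y, one with the shortest string has a largest
    -- sibling in A, and that sibling is maximal.
    maximalAbove : ∀ {y} → A y → ∃ λ b → Maximal b × y ≼ b
    maximalAbove {y} Ay with shortest {P = λ z → A z × y ≼ z} (y , Ay , ≼-refl)
    ... | (k₀ , []) , (Az₀ , y≼z₀) , _ = _ , (Az₀ , top) , y≼z₀
      where
        top : ∀ z → A z → (k₀ , []) ≼ z → (k₀ , []) ≡ z
        top _ _ z₀≼z with ≼-sameLength z₀≼z ℕ.z≤n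
        ... | refl , []≤ₛ[] = refl
    ... | (k₀ , v₀ ∷ ρ) , (Az₀ , y≼z₀) , z₀-shortest
        with siblings-boundedIn {V = λ v → A (k₀ , v ∷ ρ)} A-closed (λ Av → Av) (v₀ , Az₀)
    ...   | (m , τ) , Aτ , siblings≼
          with ≼-sameLength (siblings≼ Az₀) (z₀-shortest _ (Aτ , ≼-trans y≼z₀ (siblings≼ Az₀)))
    ...     | refl , head≤ {v = w} _ = _ , (Aτ , top) , ≼-trans y≼z₀ (siblings≼ Az₀)
      where
        top : ∀ z → A z → (k₀ , w ∷ ρ) ≼ z → (k₀ , w ∷ ρ) ≡ z
        top _ Az b≼z
          with ≼-sameLength b≼z (z₀-shortest _ (Az , ≼-trans y≼z₀ (≼-trans (siblings≼ Az₀) b≼z)))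
        ... | refl , head≤ w≤v =
          cong (λ v → k₀ , v ∷ ρ) (≤W-antisym w≤v (≼-sibling-head (siblings≼ Az)))

    maximal-sibling-≤ : ∀ {k u v r} → Maximal (k , u ∷ r) → A (k , v ∷ r) → v ≤W u
    maximal-sibling-≤ (_ , maximal) Av =
      ≮⇒≥ λ u<v → irrefl u<v (maximal _ Av (sibling≼ (inj₁ u<v)))
      where
        irrefl : ∀ {k u v r} → u < v → _≡_ {A = Z} (k , u ∷ r) (k , v ∷ r) → ⊥
        irrefl u<v refl = <-irrefl u<v

    -- A maximal a off the full strings: A ⊆ ↓ a ∪ R with a ∉ R, so A ⊆ ↓ a.
    module _ {a} (a-maximal : Maximal a) (a-notFull : ¬ Full (proj₂ a)) where

      R : Pred Z 0ℓ
      R x = (∃ λ b → Maximal b × b ≢ a × x ≼ b) ⊎ Full (proj₂ x)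

      R⊆A : R ⊆ A
      R⊆A (inj₁ (_ , (Ab , _) , _ , x≼b)) = down x≼b Ab
      R⊆A (inj₂ full) = full _

      R-chainClosed : ChainClosed R
      R-chainClosed = record { down = R-down ; ∷-sup = R-∷-sup ; limit-sup = R-limit-sup }
        where
          R-down : ∀ {x y} → x ≼ y → R y → R x
          R-down x≼y (inj₁ (b , b-max , b≢a , y≼b)) = inj₁ (b , b-max , b≢a , ≼-trans x≼y y≼b)
          R-down x≼y (inj₂ full) = inj₂ (Full-down (≼⇒⊑ x≼y) full)

          R-∷-sup : ∀ {k r} → (∀ u → R (k , u ∷ r)) → R (k , r)
          R-∷-sup {k} {r} R∷ with em {P = ∃ λ u → ¬ Full (u ∷ r)}
          ... | no none = inj₂ λ j → ∷-sup λ u → dne (λ ¬full → none (u , ¬full)) j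
          ... | yes (u₀ , ¬full) with R∷ u₀
          ...   | inj₂ full = ⊥-elim (¬full full)
          ...   | inj₁ (b , b-max , b≢a , u₀∷r≼b) with ≼-uncons u₀∷r≼b
          ...     | inj₁ r≼b = inj₁ (b , b-max , b≢a , r≼b)
          ...     | inj₂ (inj₂ (u₀≤m , consumed)) =
            ⊥-elim (¬full λ j → down (consumed j u₀ u₀≤m) (proj₁ b-max))
          ...     | inj₂ (inj₁ (refl , u′ , refl , _)) =
            let u , u′<u = W-unbounded u′
            in ⊥-elim (<⇒≱ u′<u (maximal-sibling-≤ b-max (R⊆A (R∷ u))))

          R-limit-sup : ∀ {k r w} → Limit w → (∀ u → u < w → R (k , u ∷ r)) → R (k , w ∷ r)
          R-limit-sup {k} {r} {w} w-limit R∷ with em {P = ∃ λ u → u < w × ¬ Full (u ∷ r)}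
          ... | no none =
            inj₂ λ j → limit-sup w-limit λ u u<w → dne (λ ¬full → none (u , u<w , ¬full)) j
          ... | yes (u₀ , u₀<w , ¬full) with R∷ u₀ u₀<w
          ...   | inj₂ full = ⊥-elim (¬full full)
          ...   | inj₁ (b , b-max , b≢a , u₀∷r≼b) with ≼-raise u₀<w u₀∷r≼b
          ...     | inj₁ w∷r≼b = inj₁ (b , b-max , b≢a , w∷r≼b)
          ...     | inj₂ (inj₂ (_ , _ , consumed)) =
            ⊥-elim (¬full λ j → down (consumed j) (proj₁ b-max))
          ...     | inj₂ (inj₁ (refl , u′ , refl , u′<w)) =
            let u , u′<u , u<w = proj₂ w-limit u′ u′<w
            in ⊥-elim (<⇒≱ u′<u (maximal-sibling-≤ b-max (R⊆A (R∷ u u<w))))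

      A⊆↓a : A ⊆ ↓ a
      A⊆↓a with split (↓ a , ↓-isScottClosed a) (R , chainClosed⇒scottClosed R-chainClosed) cover
        where
          cover : A ⊆ ↓ a ∪ R
          cover Ay with maximalAbove Ay
          ... | b , b-max , y≼b with em {P = b ≡ a}
          ...   | yes refl = inj₁ (≼⇒≤Z y≼b)
          ...   | no b≢a = inj₂ (inj₁ (b , b-max , b≢a , y≼b))
      ... | inj₁ A⊆↓a = A⊆↓a
      ... | inj₂ A⊆R with A⊆R (proj₁ a-maximal)
      ...   | inj₁ (b , b-max , b≢a , a≼b) =
        ⊥-elim (b≢a (sym (proj₂ a-maximal b (proj₁ b-max) a≼b)))
      ...   | inj₂ a-full = ⊥-elim (a-notFull a-full)

    -- All maximal points on full strings: A ⊆ X σ ∪ Beyond for the string σ of a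
    -- maximal a, and a ∉ Beyond by maximality, so A ⊆ X σ.
    module _ (all-full : ∀ {b} → Maximal b → Full (proj₂ b)) {a} (a-maximal : Maximal a) where

      σ : W*
      σ = proj₂ a

      Beyond : Pred Z 0ℓ
      Beyond (_ , q) = ∃ λ τ → Full τ × q ⊑ τ × ¬ τ ⊑ σ

      Beyond-chainClosed : ChainClosed Beyond
      Beyond-chainClosed = record
        { down      = Beyond-down
        ; ∷-sup     = λ {k} → Beyond-∷-sup {k}
        ; limit-sup = λ {k} → Beyond-limit-sup {k}
        }
        where
          Beyond-down : ∀ {x y} → x ≼ y → Beyond y → Beyond x
          Beyond-down x≼y (τ , τ-full , q⊑τ , τ⋢σ) = τ , τ-full , ⊑-trans (≼⇒⊑ x≼y) q⊑τ , τ⋢σ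

          Beyond-∷-sup : ∀ {k r} → (∀ u → Beyond (k , u ∷ r)) → Beyond (k , r)
          Beyond-∷-sup {k} {r} beyond with beyond W-inhabited
          ... | τ , τ-full , u∷r⊑τ , τ⋢σ with ⊑-uncons u∷r⊑τ
          ...   | inj₁ r⊑τ = τ , τ-full , r⊑τ , τ⋢σ
          ...   | inj₂ (_ , refl , _) = r , r-full , ⊑-refl , λ r⊑σ → τ⋢σ (⊑-trans ∷⊑ r⊑σ)
            where
              r-full : Full r
              r-full j = ∷-sup λ u →
                let _ , τ-full , u∷r⊑τ , _ = beyond u in Full-down u∷r⊑τ τ-full j

          Beyond-limit-sup : ∀ {k r w} → Limit w → (∀ u → u < w → Beyond (k , u ∷ r)) →
                             Beyond (k , w ∷ r)
          Beyond-limit-sup {k} {r} {w} w-limit beyond with beyond _ (proj₂ (proj₁ w-limit))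
          ... | τ , τ-full , u∷r⊑τ , τ⋢σ with ⊑-uncons u∷r⊑τ
          ...   | inj₁ r⊑τ = τ , τ-full , ⊑-trans ∷⊑ r⊑τ , τ⋢σ
          ...   | inj₂ (u′ , refl , _) with ≤W-or-> w u′
          ...     | inj₁ w≤u′ = τ , τ-full , sibling⊑ w≤u′ , τ⋢σ
          ...     | inj₂ u′<w =
            w ∷ r , w∷r-full , ⊑-refl , λ w∷r⊑σ → τ⋢σ (⊑-trans (sibling⊑ (inj₁ u′<w)) w∷r⊑σ)
            where
              w∷r-full : Full (w ∷ r)
              w∷r-full j = limit-sup w-limit λ u u<w →
                let _ , τ-full , u∷r⊑τ , _ = beyond u u<w in Full-down u∷r⊑τ τ-full j

      A⊆Xσ : A ⊆ X σ
      A⊆Xσ with split (X σ , chainClosed⇒scottClosed (X-chainClosed σ))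
                      (Beyond , chainClosed⇒scottClosed Beyond-chainClosed) cover
        where
          cover : A ⊆ X σ ∪ Beyond
          cover Ay with maximalAbove Ay
          ... | b , b-max , y≼b with em {P = proj₂ b ⊑ σ}
          ...   | yes b⊑σ = inj₁ (⊑-trans (≼⇒⊑ y≼b) b⊑σ)
          ...   | no b⋢σ = inj₂ (proj₂ b , all-full b-max , ≼⇒⊑ y≼b , b⋢σ)
      ... | inj₁ A⊆Xσ = A⊆Xσ
      ... | inj₂ A⊆Beyond with A⊆Beyond (proj₁ a-maximal)
      ...   | τ , τ-full , σ⊑τ , τ⋢σ with proj₂ a-maximal _ (τ-full (proj₁ a)) (σ⊑τ (proj₁ a))
      ...     | refl = ⊥-elim (τ⋢σ ⊑-refl)

    classify : (∃ λ a → A a × A ⊆ ↓ a) ⊎ (∃ λ σ → Full σ × A ⊆ X σ)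
    classify with em {P = ∃ λ a → Maximal a × ¬ Full (proj₂ a)}
    ... | yes (a , a-max , a-notFull) = inj₁ (a , proj₁ a-max , A⊆↓a a-max a-notFull)
    ... | no none with maximalAbove (proj₂ (proj₁ (proj₂ A-irreducible)))
    ...   | a , a-max , _ = inj₂ (proj₂ a , all-full a-max , A⊆Xσ all-full a-max)
      where
        all-full : ∀ {b} → Maximal b → Full (proj₂ b)
        all-full b-max = dne λ ¬full → none (_ , b-max , ¬full)

  Z-dominated : Dominated
  Z-dominated 𝒜 (A , A-irreducible) η[A]⊆𝒜 with Irreducible.classify A A-irreducible
  ... | inj₁ (a , Aa , A⊆↓a) = proj₁ (proj₂ 𝒜) _ (η a) A⊆↓a (η[A]⊆𝒜 Aa)
  ... | inj₂ (σ , σ-full , A⊆Xσ) =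
    proj₁ (proj₂ 𝒜) _ (X̂ σ) A⊆Xσ (X̂∈ 𝒜 σ λ u → η[A]⊆𝒜 (σ-full u))

mainTheorem6 : (Ω : Omega1) → (∀ {ℓ : Level} → ExcludedMiddle ℓ) →
    OrderIso (Construction.ΓZ Ω) (Construction._⊑ΓZ_ Ω)
             (Construction.ΓẐ Ω) (Construction._⊑ΓẐ_ Ω)
mainTheorem6 Ω em = dominated⇒Γ≅Γ̂ Z-dominated
  where open ZProperties Ω em
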